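{- Let $d,n,m,s$ be positive integers with $d\le 2$ and $s\ge 3$ satisfying $F_n^s+F_{n+d}^s=F_m$. Then $n+d<3s$.
   Context: The Fibonacci sequence is defined by $F_0=0$, $F_1=1$ and $F_{n+2}=F_{n+1}+F_n$ for $n\ge 0$. -}

module Defs where

open import Data.Nat using (ℕ; zero; suc; _+_)

F : ℕ → ℕ
F zero = zero
F (suc zero) = suc zero
F (suc (suc n)) = F (suc n) + F n

-- Write k = q + 2, N = F k, a = F (q + 1), b = F q, so that N = a + b, and let s = t + 1 with 3 s ≤ k;
-- the base B of the smaller power is a (d = 1) or b (d = 2).  Two growth estimates trap the index:
-- F (2 + t k) ≤ 3^t N^t < F m, and F m ≥ F (q + t k) ≥ (21/10)^t b N^t would contradict
-- F m = B^s + N^s, 3 B ≤ 2 N and 3 N ≤ 8 b.  Hence m = r + t k with 2 < r < q.  The addition formula gives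
-- F (x + k) ≡ a F x (mod N), so F m ≡ a^t F r, whereas F m ≡ B^s ≡ ±a^s because b ≡ -a.  Since a is
-- coprime to N this forces F r ≡ ±a (mod N), impossible as 0 < F r < a and 0 < F r + a < N.
module Submission where

open import Defs
open import Data.Nat using (ℕ; _+_; _*_; _^_; _≤_; _<_)
open import Relation.Binary.PropositionalEquality using (_≡_)
open import Data.Nat.Base
  using (zero; suc; _∸_; _>_; _≰_; z≤n; s≤s; _≤′_; ≤′-reflexive; ≤′-step; NonZero; >-nonZero)
open import Data.Nat.Properties
open import Data.Nat.Divisibility using (_∣_; divides; ∣m+n∣m⇒∣n; m∣m*n; >⇒∤)
open import Data.Nat.Coprimality using (Coprime; coprime-divisor; coprime-+)
import Data.Nat.Coprimality as Coprime
open import Data.Nat.Tactic.RingSolver using (solve-∀)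
import Algebra.Properties.CommutativeSemigroup as CommutativeSemigroupProperties
open import Data.Sum using (_⊎_; inj₁; inj₂)
open import Level using (0ℓ)
open import Relation.Binary.Bundles using (Setoid)
open import Relation.Binary.PropositionalEquality using (refl; sym; trans; cong; cong₂; subst; subst₂; module ≡-Reasoning)
import Relation.Binary.Reasoning.Setoid as SetoidReasoning
open import Relation.Nullary using (¬_; contradiction)

module +-CS = CommutativeSemigroupProperties +-commutativeSemigroup
module *-CS = CommutativeSemigroupProperties *-commutativeSemigroup

F[n]≤F[1+n] : ∀ n → F n ≤ F (suc n)
F[n]≤F[1+n] zero          = z≤n
F[n]≤F[1+n] (suc zero)    = ≤-refl
F[n]≤F[1+n] (suc (suc n)) = m≤m+n _ _

F-mono-≤ : ∀ {m n} → m ≤ n → F m ≤ F n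
F-mono-≤ m≤n = mono (≤⇒≤′ m≤n)
  where
  mono : ∀ {m n} → m ≤′ n → F m ≤ F n
  mono (≤′-reflexive refl) = ≤-refl
  mono (≤′-step {n} m≤′n)  = ≤-trans (mono m≤′n) (F[n]≤F[1+n] n)

F[1+n]>0 : ∀ n → F (suc n) > 0
F[1+n]>0 n = F-mono-≤ {1} {suc n} (s≤s z≤n)

F[n]<F[1+n] : ∀ {n} → 2 ≤ n → F n < F (suc n)
F[n]<F[1+n] {suc (suc n)} (s≤s (s≤s z≤n)) = m<m+n _ (F[1+n]>0 n)

F-mono-< : ∀ {m n} → 2 ≤ m → m < n → F m < F n
F-mono-< 2≤m m<n = <-≤-trans (F[n]<F[1+n] 2≤m) (F-mono-≤ m<n)

F[2+n]≤F[1+n]+F[1+n] : ∀ n → F (2 + n) ≤ F (1 + n) + F (1 + n)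
F[2+n]≤F[1+n]+F[1+n] n = +-monoʳ-≤ (F (suc n)) (F[n]≤F[1+n] n)

3*F[n]≤F[3+n] : ∀ n → 3 * F n ≤ F (3 + n)
3*F[n]≤F[3+n] n = begin
  3 * F n                       ≡⟨ triple (F n) ⟩
  (F n + F n) + F n             ≤⟨ +-mono-≤ (+-monoˡ-≤ (F n) (F[n]≤F[1+n] n)) (F[n]≤F[1+n] n) ⟩
  (F (1 + n) + F n) + F (1 + n) ∎
  where
  open ≤-Reasoning
  triple : ∀ x → 3 * x ≡ (x + x) + x
  triple = solve-∀

3*F[n]≤2*F[1+n] : ∀ {n} → 2 ≤ n → 3 * F n ≤ 2 * F (suc n)
3*F[n]≤2*F[1+n] {suc (suc n)} (s≤s (s≤s z≤n)) = begin
  3 * F (2 + n)                         ≡⟨ split (F (1 + n)) (F n) ⟩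
  2 * F (2 + n) + F (1 + n) + F n       ≤⟨ +-monoʳ-≤ (2 * F (2 + n) + F (1 + n)) (F[n]≤F[1+n] n) ⟩
  2 * F (2 + n) + F (1 + n) + F (1 + n) ≡⟨ merge (F (1 + n)) (F n) ⟩
  2 * F (3 + n)                         ∎
  where
  open ≤-Reasoning
  split : ∀ x z → 3 * (x + z) ≡ 2 * (x + z) + x + z
  split = solve-∀
  merge : ∀ x z → 2 * (x + z) + x + x ≡ 2 * ((x + z) + x)
  merge = solve-∀

3*F[1+n]≤5*F[n] : ∀ {n} → 3 ≤ n → 3 * F (suc n) ≤ 5 * F n
3*F[1+n]≤5*F[n] {suc n} (s≤s 2≤n) = begin
  3 * F (2 + n)                  ≡⟨ *-distribˡ-+ 3 (F (suc n)) (F n) ⟩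
  3 * F (suc n) + 3 * F n        ≤⟨ +-monoʳ-≤ (3 * F (suc n)) (3*F[n]≤2*F[1+n] 2≤n) ⟩
  3 * F (suc n) + 2 * F (suc n)  ≡⟨ *-distribʳ-+ (F (suc n)) 3 2 ⟨
  5 * F (suc n)                  ∎
  where open ≤-Reasoning

3*F[2+n]≤8*F[n] : ∀ {n} → 3 ≤ n → 3 * F (2 + n) ≤ 8 * F n
3*F[2+n]≤8*F[n] {n} 3≤n = begin
  3 * F (2 + n)             ≡⟨ *-distribˡ-+ 3 (F (suc n)) (F n) ⟩
  3 * F (suc n) + 3 * F n   ≤⟨ +-monoˡ-≤ (3 * F n) (3*F[1+n]≤5*F[n] 3≤n) ⟩
  5 * F n + 3 * F n         ≡⟨ *-distribʳ-+ (F n) 5 3 ⟨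
  8 * F n                   ∎
  where open ≤-Reasoning

F[m+1+n]≡F[1+m]*F[1+n]+F[m]*F[n] : ∀ m n → F (m + suc n) ≡ F (suc m) * F (suc n) + F m * F n
F[m+1+n]≡F[1+m]*F[1+n]+F[m]*F[n] zero          n = sym (trans (+-identityʳ (1 * F (suc n))) (*-identityˡ (F (suc n))))
F[m+1+n]≡F[1+m]*F[1+n]+F[m]*F[n] (suc zero)    n = sym (cong₂ _+_ (*-identityˡ (F (suc n))) (*-identityˡ (F n)))
F[m+1+n]≡F[1+m]*F[1+n]+F[m]*F[n] (suc (suc m)) n = begin
  F (suc m + suc n) + F (m + suc n)
    ≡⟨ cong₂ _+_ (F[m+1+n]≡F[1+m]*F[1+n]+F[m]*F[n] (suc m) n) (F[m+1+n]≡F[1+m]*F[1+n]+F[m]*F[n] m n) ⟩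
  (F (2 + m) * F (suc n) + F (1 + m) * F n) + (F (1 + m) * F (suc n) + F m * F n)
    ≡⟨ regroup (F (2 + m)) (F (1 + m)) (F m) (F (suc n)) (F n) ⟩
  (F (2 + m) + F (1 + m)) * F (suc n) + (F (1 + m) + F m) * F n ∎
  where
  open ≡-Reasoning
  regroup : ∀ x y z u v → (x * u + y * v) + (y * u + z * v) ≡ (x + y) * u + (y + z) * v
  regroup = solve-∀

F[2+n]-coprime-F[1+n] : ∀ n → Coprime (F (2 + n)) (F (1 + n))
F[2+n]-coprime-F[1+n] zero    = Coprime.sym (Coprime.1-coprimeTo 1)
F[2+n]-coprime-F[1+n] (suc n) = coprime-+ (Coprime.sym (F[2+n]-coprime-F[1+n] n))

3^n≤F[3*[1+n]] : ∀ n → 3 ^ n ≤ F (3 * suc n)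
3^n≤F[3*[1+n]] zero    = s≤s z≤n
3^n≤F[3*[1+n]] (suc n) = begin
  3 * 3 ^ n               ≤⟨ *-monoʳ-≤ 3 (3^n≤F[3*[1+n]] n) ⟩
  3 * F (3 * suc n)       ≤⟨ 3*F[n]≤F[3+n] (3 * suc n) ⟩
  F (3 + 3 * suc n)       ≡⟨ cong F (*-suc 3 (suc n)) ⟨
  F (3 * suc (suc n))     ∎
  where open ≤-Reasoning

^-distribʳ-* : ∀ m n o → (m * n) ^ o ≡ m ^ o * n ^ o
^-distribʳ-* m n zero    = refl
^-distribʳ-* m n (suc o) = begin
  (m * n) * (m * n) ^ o     ≡⟨ cong ((m * n) *_) (^-distribʳ-* m n o) ⟩
  (m * n) * (m ^ o * n ^ o) ≡⟨ *-CS.interchange m n (m ^ o) (n ^ o) ⟩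
  (m * m ^ o) * (n * n ^ o) ∎
  where open ≡-Reasoning

-- Congruence on ℕ stated without truncated subtraction.
infix 4 _≡_[mod_]

record _≡_[mod_] (x y N : ℕ) : Set where
  constructor congruent
  field
    u v : ℕ
    eq  : x + N * u ≡ y + N * v

module _ {N : ℕ} where

  mod-refl : ∀ {x} → x ≡ x [mod N ]
  mod-refl = congruent 0 0 refl

  mod-sym : ∀ {x y} → x ≡ y [mod N ] → y ≡ x [mod N ]
  mod-sym (congruent u v eq) = congruent v u (sym eq)

  mod-trans : ∀ {x y z} → x ≡ y [mod N ] → y ≡ z [mod N ] → x ≡ z [mod N ]
  mod-trans {x} {y} {z} (congruent u v x≈y) (congruent u′ v′ y≈z) = congruent (u + u′) (v′ + v) (begin
    x + N * (u + u′)       ≡⟨ split x u u′ ⟩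
    (x + N * u) + N * u′   ≡⟨ cong (_+ N * u′) x≈y ⟩
    (y + N * v) + N * u′   ≡⟨ swap y v u′ ⟩
    (y + N * u′) + N * v   ≡⟨ cong (_+ N * v) y≈z ⟩
    (z + N * v′) + N * v   ≡⟨ split z v′ v ⟨
    z + N * (v′ + v)       ∎)
    where
    open ≡-Reasoning
    split : ∀ w a b → w + N * (a + b) ≡ (w + N * a) + N * b
    split w a b = trans (cong (w +_) (*-distribˡ-+ N a b)) (sym (+-assoc w _ _))
    swap : ∀ w a b → (w + N * a) + N * b ≡ (w + N * b) + N * a
    swap w a b = +-CS.xy∙z≈xz∙y w (N * a) (N * b)

  mod-+-cong : ∀ {x y x′ y′} → x ≡ y [mod N ] → x′ ≡ y′ [mod N ] → x + x′ ≡ y + y′ [mod N ]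
  mod-+-cong {x} {y} {x′} {y′} (congruent u v x≈y) (congruent u′ v′ x′≈y′) = congruent (u + u′) (v + v′) (begin
    (x + x′) + N * (u + u′)       ≡⟨ distribute x x′ N u u′ ⟩
    (x + N * u) + (x′ + N * u′)   ≡⟨ cong₂ _+_ x≈y x′≈y′ ⟩
    (y + N * v) + (y′ + N * v′)   ≡⟨ distribute y y′ N v v′ ⟨
    (y + y′) + N * (v + v′)       ∎)
    where
    open ≡-Reasoning
    distribute : ∀ a b n c d → (a + b) + n * (c + d) ≡ (a + n * c) + (b + n * d)
    distribute = solve-∀

  mod-*-congˡ : ∀ c {x y} → x ≡ y [mod N ] → c * x ≡ c * y [mod N ]
  mod-*-congˡ c {x} {y} (congruent u v x≈y) = congruent (c * u) (c * v) (begin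
    c * x + N * (c * u)    ≡⟨ factor x u ⟩
    c * (x + N * u)        ≡⟨ cong (c *_) x≈y ⟩
    c * (y + N * v)        ≡⟨ factor y v ⟨
    c * y + N * (c * v)    ∎)
    where
    open ≡-Reasoning
    factor : ∀ w a → c * w + N * (c * a) ≡ c * (w + N * a)
    factor w a = trans (cong (c * w +_) (*-CS.x∙yz≈y∙xz N c a)) (sym (*-distribˡ-+ c w (N * a)))

  mod-+-multiple : ∀ x z → x + N * z ≡ x [mod N ]
  mod-+-multiple x z = congruent 0 z (trans (cong (x + N * z +_) (*-zeroʳ N)) (+-identityʳ _))

  mod⇒∣∸ : ∀ {x y} → x ≡ y [mod N ] → x ≤ y → N ∣ y ∸ x
  mod⇒∣∸ {x} {y} (congruent u v x≈y) x≤y = ∣m+n∣m⇒∣n (subst (N ∣_) Nu≡Nv+[y∸x] (m∣m*n u)) (m∣m*n v)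
    where
    open ≡-Reasoning
    Nu≡Nv+[y∸x] : N * u ≡ N * v + (y ∸ x)
    Nu≡Nv+[y∸x] = +-cancelˡ-≡ x _ _ (begin
      x + N * u               ≡⟨ x≈y ⟩
      y + N * v               ≡⟨ cong (_+ N * v) (m+[n∸m]≡n x≤y) ⟨
      x + (y ∸ x) + N * v     ≡⟨ +-CS.xy∙z≈x∙zy x (y ∸ x) (N * v) ⟩
      x + (N * v + (y ∸ x))   ∎)

  ∣∸⇒mod : ∀ {x y} → N ∣ y ∸ x → x ≤ y → x ≡ y [mod N ]
  ∣∸⇒mod {x} {y} (divides w y∸x≡w*N) x≤y = congruent w 0 (begin
    x + N * w         ≡⟨ cong (x +_) (trans (*-comm N w) (sym y∸x≡w*N)) ⟩
    x + (y ∸ x)       ≡⟨ m+[n∸m]≡n x≤y ⟩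
    y                 ≡⟨ +-identityʳ y ⟨
    y + 0             ≡⟨ cong (y +_) (*-zeroʳ N) ⟨
    y + N * 0         ∎)
    where open ≡-Reasoning

  mod-≤⇒≡ : ∀ {x y} → x ≡ y [mod N ] → x ≤ y → y < N → x ≡ y
  mod-≤⇒≡ {x} {y} x≈y x≤y y<N = ≤-antisym x≤y (m∸n≡0⇒m≤n (multiple<N⇒≡0 (mod⇒∣∸ x≈y x≤y) y∸x<N))
    where
    y∸x<N : y ∸ x < N
    y∸x<N = ≤-<-trans (m∸n≤m y x) y<N
    multiple<N⇒≡0 : ∀ {e} → N ∣ e → e < N → e ≡ 0
    multiple<N⇒≡0 {zero}  _   _   = refl
    multiple<N⇒≡0 {suc e} N∣e e<N = contradiction N∣e (>⇒∤ e<N)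

  mod-<⇒≡ : ∀ {x y} → x ≡ y [mod N ] → x < N → y < N → x ≡ y
  mod-<⇒≡ {x} {y} x≈y x<N y<N with ≤-total x y
  ... | inj₁ x≤y = mod-≤⇒≡ x≈y x≤y y<N
  ... | inj₂ y≤x = sym (mod-≤⇒≡ (mod-sym x≈y) y≤x x<N)

  mod-*-cancelˡ-≤ : ∀ {c} → Coprime N c → ∀ {x y} → c * x ≡ c * y [mod N ] → x ≤ y → x ≡ y [mod N ]
  mod-*-cancelˡ-≤ {c} N⊥c {x} {y} cx≈cy x≤y = ∣∸⇒mod (coprime-divisor N⊥c N∣c*[y∸x]) x≤y
    where
    N∣c*[y∸x] : N ∣ c * (y ∸ x)
    N∣c*[y∸x] = subst (N ∣_) (sym (*-distribˡ-∸ c y x)) (mod⇒∣∸ cx≈cy (*-monoʳ-≤ c x≤y))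

  mod-*-cancelˡ : ∀ {c} → Coprime N c → ∀ {x y} → c * x ≡ c * y [mod N ] → x ≡ y [mod N ]
  mod-*-cancelˡ N⊥c {x} {y} cx≈cy with ≤-total x y
  ... | inj₁ x≤y = mod-*-cancelˡ-≤ N⊥c cx≈cy x≤y
  ... | inj₂ y≤x = mod-sym (mod-*-cancelˡ-≤ N⊥c (mod-sym cx≈cy) y≤x)

  mod-^-*-cancelˡ : ∀ {c} → Coprime N c → ∀ j {x y} → c ^ j * x ≡ c ^ j * y [mod N ] → x ≡ y [mod N ]
  mod-^-*-cancelˡ N⊥c zero    {x} {y} x≈y = subst₂ _≡_[mod N ] (*-identityˡ x) (*-identityˡ y) x≈y
  mod-^-*-cancelˡ {c} N⊥c (suc j) {x} {y} cʲ⁺¹x≈cʲ⁺¹y =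
    mod-^-*-cancelˡ N⊥c j (mod-*-cancelˡ N⊥c (subst₂ _≡_[mod N ] (*-assoc c (c ^ j) x) (*-assoc c (c ^ j) y) cʲ⁺¹x≈cʲ⁺¹y))

mod-setoid : ℕ → Setoid 0ℓ 0ℓ
mod-setoid N = record
  { Carrier       = ℕ
  ; _≈_           = _≡_[mod N ]
  ; isEquivalence = record { refl = mod-refl ; sym = mod-sym ; trans = mod-trans }
  }

module mod-Reasoning (N : ℕ) = SetoidReasoning (mod-setoid N)

F[x+1+n]≡F[n]*F[x] : ∀ x n → F (x + suc n) ≡ F n * F x [mod F (suc n) ]
F[x+1+n]≡F[n]*F[x] x n = begin
  F (x + suc n)                         ≡⟨ F[m+1+n]≡F[1+m]*F[1+n]+F[m]*F[n] x n ⟩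
  F (suc x) * F (suc n) + F x * F n     ≡⟨ reorder (F (suc x)) (F (suc n)) (F x) (F n) ⟩
  F n * F x + F (suc n) * F (suc x)     ≈⟨ mod-+-multiple (F n * F x) (F (suc x)) ⟩
  F n * F x                             ∎
  where
  open mod-Reasoning (F (suc n))
  reorder : ∀ a b c d → a * b + c * d ≡ d * c + b * a
  reorder = solve-∀

F[x+j*[1+n]]≡F[n]^j*F[x] : ∀ x n j → F (x + j * suc n) ≡ F n ^ j * F x [mod F (suc n) ]
F[x+j*[1+n]]≡F[n]^j*F[x] x n zero = begin
  F (x + 0)     ≡⟨ cong F (+-identityʳ x) ⟩
  F x           ≡⟨ *-identityˡ (F x) ⟨
  1 * F x       ∎
  where open mod-Reasoning (F (suc n))
F[x+j*[1+n]]≡F[n]^j*F[x] x n (suc j) = begin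
  F (x + (suc n + j * suc n))        ≡⟨ cong F (+-CS.x∙yz≈xz∙y x (suc n) (j * suc n)) ⟩
  F (x + j * suc n + suc n)          ≈⟨ F[x+1+n]≡F[n]*F[x] (x + j * suc n) n ⟩
  F n * F (x + j * suc n)            ≈⟨ mod-*-congˡ (F n) (F[x+j*[1+n]]≡F[n]^j*F[x] x n j) ⟩
  F n * (F n ^ j * F x)              ≡⟨ *-assoc (F n) (F n ^ j) (F x) ⟨
  F n ^ suc j * F x                  ∎
  where open mod-Reasoning (F (suc n))

b^s≡±a^s[mod[a+b]] : ∀ a b s → b ^ s ≡ a ^ s [mod a + b ] ⊎ b ^ s + a ^ s ≡ 0 [mod a + b ]
b^s≡±a^s[mod[a+b]] a b zero = inj₁ mod-refl
b^s≡±a^s[mod[a+b]] a b (suc s) with b^s≡±a^s[mod[a+b]] a b s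
... | inj₁ bˢ≈aˢ = inj₂ (begin
  b * b ^ s + a * a ^ s       ≈⟨ mod-+-cong (mod-*-congˡ b bˢ≈aˢ) mod-refl ⟩
  b * a ^ s + a * a ^ s       ≡⟨ *-distribʳ-+ (a ^ s) b a ⟨
  (b + a) * a ^ s             ≡⟨ cong (_* a ^ s) (+-comm b a) ⟩
  (a + b) * a ^ s             ≈⟨ mod-+-multiple 0 (a ^ s) ⟩
  0                           ∎)
  where open mod-Reasoning (a + b)
... | inj₂ bˢ+aˢ≈0 = inj₁ (begin
  b * b ^ s                         ≡⟨ trans (cong (b * b ^ s +_) (*-zeroʳ a)) (+-identityʳ (b * b ^ s)) ⟨
  b * b ^ s + a * 0                 ≈⟨ mod-+-cong mod-refl (mod-*-congˡ a (mod-sym bˢ+aˢ≈0)) ⟩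
  b * b ^ s + a * (b ^ s + a ^ s)   ≡⟨ regroup a b (b ^ s) (a ^ s) ⟩
  (a + b) * b ^ s + a * a ^ s       ≈⟨ mod-+-cong (mod-+-multiple 0 (b ^ s)) mod-refl ⟩
  a * a ^ s                         ∎)
  where
  open mod-Reasoning (a + b)
  regroup : ∀ a b x y → b * x + a * (x + y) ≡ (a + b) * x + a * y
  regroup = solve-∀

F[2+j*[1+n]]≤3^j*F[1+n]^j : ∀ n j → F (2 + j * suc n) ≤ 3 ^ j * F (suc n) ^ j
F[2+j*[1+n]]≤3^j*F[1+n]^j n zero    = ≤-refl
F[2+j*[1+n]]≤3^j*F[1+n]^j n (suc j) = begin
  F (2 + (suc n + j * suc n))                  ≡⟨ cong F (+-CS.x∙yz≈xz∙y 2 (suc n) (j * suc n)) ⟩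
  F (x + suc n)                                ≡⟨ F[m+1+n]≡F[1+m]*F[1+n]+F[m]*F[n] x n ⟩
  F (suc x) * F (suc n) + F x * F n            ≤⟨ +-mono-≤ (*-monoˡ-≤ (F (suc n)) (F[2+n]≤F[1+n]+F[1+n] (1 + j * suc n)))
                                                          (*-monoʳ-≤ (F x) (F[n]≤F[1+n] n)) ⟩
  (F x + F x) * F (suc n) + F x * F (suc n)    ≡⟨ triple (F x) (F (suc n)) ⟩
  3 * (F x * F (suc n))                        ≤⟨ *-monoʳ-≤ 3 (*-monoˡ-≤ (F (suc n)) (F[2+j*[1+n]]≤3^j*F[1+n]^j n j)) ⟩
  3 * (3 ^ j * F (suc n) ^ j * F (suc n))      ≡⟨ regroup (3 ^ j) (F (suc n) ^ j) (F (suc n)) ⟩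
  3 ^ suc j * F (suc n) ^ suc j                ∎
  where
  open ≤-Reasoning
  x : ℕ
  x = 2 + j * suc n
  triple : ∀ y z → (y + y) * z + y * z ≡ 3 * (y * z)
  triple = solve-∀
  regroup : ∀ p q z → 3 * (p * q * z) ≡ (3 * p) * (z * q)
  regroup = solve-∀

21*F[x]*F[1+n]≤10*F[x+1+n] : ∀ {x n} → 2 ≤ x → 3 ≤ n → 21 * (F x * F (suc n)) ≤ 10 * F (x + suc n)
21*F[x]*F[1+n]≤10*F[x+1+n] {x} {n} 2≤x 3≤n = begin
  21 * (F x * F (suc n))                                 ≡⟨ split (F x) (F (suc n)) ⟩
  5 * (3 * F x) * F (suc n) + 2 * F x * (3 * F (suc n))  ≤⟨ +-mono-≤ (*-monoˡ-≤ (F (suc n)) (*-monoʳ-≤ 5 (3*F[n]≤2*F[1+n] 2≤x)))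
                                                                    (*-monoʳ-≤ (2 * F x) (3*F[1+n]≤5*F[n] 3≤n)) ⟩
  5 * (2 * F (suc x)) * F (suc n) + 2 * F x * (5 * F n)  ≡⟨ merge (F (suc x)) (F x) (F (suc n)) (F n) ⟩
  10 * (F (suc x) * F (suc n) + F x * F n)               ≡⟨ cong (10 *_) (F[m+1+n]≡F[1+m]*F[1+n]+F[m]*F[n] x n) ⟨
  10 * F (x + suc n)                                     ∎
  where
  open ≤-Reasoning
  split : ∀ y z → 21 * (y * z) ≡ 5 * (3 * y) * z + 2 * y * (3 * z)
  split = solve-∀
  merge : ∀ y′ y z z′ → 5 * (2 * y′) * z + 2 * y * (5 * z′) ≡ 10 * (y′ * z + y * z′)
  merge = solve-∀

21^j*F[x]*F[1+n]^j≤10^j*F[x+j*[1+n]] : ∀ {x n} → 2 ≤ x → 3 ≤ n → ∀ j →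
  21 ^ j * (F x * F (suc n) ^ j) ≤ 10 ^ j * F (x + j * suc n)
21^j*F[x]*F[1+n]^j≤10^j*F[x+j*[1+n]] {x} {n} 2≤x 3≤n zero =
  ≤-reflexive (cong (1 *_) (trans (*-identityʳ (F x)) (cong F (sym (+-identityʳ x)))))
21^j*F[x]*F[1+n]^j≤10^j*F[x+j*[1+n]] {x} {n} 2≤x 3≤n (suc j) = begin
  21 * 21 ^ j * (F x * (K * K ^ j))       ≡⟨ regroup (21 ^ j) (F x) K (K ^ j) ⟩
  21 * K * (21 ^ j * (F x * K ^ j))       ≤⟨ *-monoʳ-≤ (21 * K) (21^j*F[x]*F[1+n]^j≤10^j*F[x+j*[1+n]] 2≤x 3≤n j) ⟩
  21 * K * (10 ^ j * F y)                 ≡⟨ regroup′ K (10 ^ j) (F y) ⟩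
  10 ^ j * (21 * (F y * K))               ≤⟨ *-monoʳ-≤ (10 ^ j) (21*F[x]*F[1+n]≤10*F[x+1+n] (≤-trans 2≤x (m≤m+n x _)) 3≤n) ⟩
  10 ^ j * (10 * F (y + suc n))           ≡⟨ *-CS.x∙yz≈yx∙z (10 ^ j) 10 (F (y + suc n)) ⟩
  10 * 10 ^ j * F (y + suc n)             ≡⟨ cong (λ i → 10 * 10 ^ j * F i) (+-CS.x∙yz≈xz∙y x (suc n) (j * suc n)) ⟨
  10 * 10 ^ j * F (x + (suc n + j * suc n)) ∎
  where
  open ≤-Reasoning
  K y : ℕ
  K = F (suc n)
  y = x + j * suc n
  regroup : ∀ p f k q → 21 * p * (f * (k * q)) ≡ 21 * k * (p * (f * q))
  regroup = solve-∀
  regroup′ : ∀ k p f → 21 * k * (p * f) ≡ p * (21 * (f * k))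
  regroup′ = solve-∀

8*10^t*[2^[1+t]+3^[1+t]]<3^[2+t]*21^t : ∀ {t} → 2 ≤ t → 8 * 10 ^ t * (2 ^ suc t + 3 ^ suc t) < 3 ^ (2 + t) * 21 ^ t
8*10^t*[2^[1+t]+3^[1+t]]<3^[2+t]*21^t 2≤t = from-2 (≤⇒≤′ 2≤t)
  where
  from-2 : ∀ {t} → 2 ≤′ t → 8 * 10 ^ t * (2 ^ suc t + 3 ^ suc t) < 3 ^ (2 + t) * 21 ^ t
  from-2 (≤′-reflexive refl) = ≤ᵇ⇒≤ 28001 35721 _
  from-2 (≤′-step {t} 2≤′t)  = begin-strict
    8 * (10 * P) * (2 * A + 3 * B)  ≤⟨ *-monoʳ-≤ (8 * (10 * P)) (+-monoˡ-≤ (3 * B) (*-monoˡ-≤ A (≤ᵇ⇒≤ 2 3 _))) ⟩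
    8 * (10 * P) * (3 * A + 3 * B)  ≡⟨ regroup P A B ⟩
    30 * (8 * P * (A + B))          <⟨ *-monoʳ-< 30 (from-2 2≤′t) ⟩
    30 * (C * D)                    ≤⟨ *-monoˡ-≤ (C * D) (≤ᵇ⇒≤ 30 63 _) ⟩
    63 * (C * D)                    ≡⟨ regroup′ C D ⟩
    3 * C * (21 * D)                ∎
    where
    open ≤-Reasoning
    P A B C D : ℕ
    P = 10 ^ t
    A = 2 ^ suc t
    B = 3 ^ suc t
    C = 3 ^ (2 + t)
    D = 21 ^ t
    regroup : ∀ p a b → 8 * (10 * p) * (3 * a + 3 * b) ≡ 30 * (8 * p * (a + b))
    regroup = solve-∀
    regroup′ : ∀ c d → 63 * (c * d) ≡ 3 * c * (21 * d)
    regroup′ = solve-∀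

module _ {q t B m : ℕ} (2≤t : 2 ≤ t) (3[1+t]≤2+q : 3 * suc t ≤ 2 + q)
         (B>0 : B > 0) (B≤F[1+q] : B ≤ F (suc q))
         (F[m]≡B^s+N^s : F m ≡ B ^ suc t + F (2 + q) ^ suc t) where

  private
    k s N a b : ℕ
    k = 2 + q
    s = suc t
    N = F k
    a = F (suc q)
    b = F q

    3≤q : 3 ≤ q
    3≤q = ≤-trans (≤ᵇ⇒≤ 3 7 _) (≤-pred (≤-pred (≤-trans (*-monoʳ-≤ 3 (s≤s 2≤t)) 3[1+t]≤2+q)))

    b>0 : b > 0
    b>0 = F-mono-≤ {1} {q} (≤-trans (s≤s z≤n) 3≤q)

    a<N : a < N
    a<N = m<m+n a b>0

    N>0 : N > 0
    N>0 = F[1+n]>0 (suc q)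

  2+t*k<m : 2 + t * k < m
  2+t*k<m = ≰⇒> λ m≤2+t*k → <⇒≱ N^s<F[m] (begin
    F m             ≤⟨ F-mono-≤ m≤2+t*k ⟩
    F (2 + t * k)   ≤⟨ F[2+j*[1+n]]≤3^j*F[1+n]^j (suc q) t ⟩
    3 ^ t * N ^ t   ≤⟨ *-monoˡ-≤ (N ^ t) (≤-trans (3^n≤F[3*[1+n]] t) (F-mono-≤ 3[1+t]≤2+q)) ⟩
    N ^ s           ∎)
    where
    open ≤-Reasoning
    N^s<F[m] : N ^ s < F m
    N^s<F[m] = subst (N ^ s <_) (sym F[m]≡B^s+N^s) (m<n+m (N ^ s) (m^n>0 B {{>-nonZero B>0}} s))

  private
    3N≤8b : 3 * N ≤ 8 * b
    3N≤8b = 3*F[2+n]≤8*F[n] 3≤q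

    3^s*B^s≤2^s*N^s : 3 ^ s * B ^ s ≤ 2 ^ s * N ^ s
    3^s*B^s≤2^s*N^s = subst₂ _≤_ (^-distribʳ-* 3 B s) (^-distribʳ-* 2 N s) (^-monoˡ-≤ s (begin
      3 * B   ≤⟨ *-monoʳ-≤ 3 B≤F[1+q] ⟩
      3 * a   ≤⟨ 3*F[n]≤2*F[1+n] (≤-trans (s≤s (s≤s z≤n)) (m≤n⇒m≤1+n 3≤q)) ⟩
      2 * N   ∎))
      where open ≤-Reasoning

    q+t*k≤m⇒21^t*b*N^t≤10^t*F[m] : q + t * k ≤ m → 21 ^ t * (b * N ^ t) ≤ 10 ^ t * F m
    q+t*k≤m⇒21^t*b*N^t≤10^t*F[m] q+t*k≤m = begin
      21 ^ t * (b * N ^ t)     ≤⟨ 21^j*F[x]*F[1+n]^j≤10^j*F[x+j*[1+n]] (≤-trans (s≤s (s≤s z≤n)) 3≤q) (m≤n⇒m≤1+n 3≤q) t ⟩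
      10 ^ t * F (q + t * k)   ≤⟨ *-monoʳ-≤ (10 ^ t) (F-mono-≤ q+t*k≤m) ⟩
      10 ^ t * F m             ∎
      where open ≤-Reasoning

    q+t*k≤m⇒3^[2+t]*21^t≤8*10^t*[2^s+3^s] : q + t * k ≤ m → 3 ^ (2 + t) * 21 ^ t ≤ 8 * 10 ^ t * (2 ^ s + 3 ^ s)
    q+t*k≤m⇒3^[2+t]*21^t≤8*10^t*[2^s+3^s] q+t*k≤m = *-cancelʳ-≤ _ _ (N ^ s) {{N^s≢0}} (begin
      3 * 3 ^ s * 21 ^ t * (N * N ^ t)              ≡⟨ regroup₁ (3 ^ s) (21 ^ t) N (N ^ t) ⟩
      3 ^ s * 21 ^ t * (3 * N * N ^ t)              ≤⟨ *-monoʳ-≤ (3 ^ s * 21 ^ t) (*-monoˡ-≤ (N ^ t) 3N≤8b) ⟩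
      3 ^ s * 21 ^ t * (8 * b * N ^ t)              ≡⟨ regroup₂ (3 ^ s) (21 ^ t) b (N ^ t) ⟩
      8 * 3 ^ s * (21 ^ t * (b * N ^ t))            ≤⟨ *-monoʳ-≤ (8 * 3 ^ s) (q+t*k≤m⇒21^t*b*N^t≤10^t*F[m] q+t*k≤m) ⟩
      8 * 3 ^ s * (10 ^ t * F m)                    ≡⟨ cong (λ x → 8 * 3 ^ s * (10 ^ t * x)) F[m]≡B^s+N^s ⟩
      8 * 3 ^ s * (10 ^ t * (B ^ s + N ^ s))        ≡⟨ regroup₃ (3 ^ s) (10 ^ t) (B ^ s) (N ^ s) ⟩
      8 * 10 ^ t * (3 ^ s * B ^ s + 3 ^ s * N ^ s)  ≤⟨ *-monoʳ-≤ (8 * 10 ^ t) (+-monoˡ-≤ (3 ^ s * N ^ s) 3^s*B^s≤2^s*N^s) ⟩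
      8 * 10 ^ t * (2 ^ s * N ^ s + 3 ^ s * N ^ s)  ≡⟨ regroup₄ (8 * 10 ^ t) (2 ^ s) (3 ^ s) (N ^ s) ⟩
      8 * 10 ^ t * (2 ^ s + 3 ^ s) * N ^ s          ∎)
      where
      open ≤-Reasoning
      N^s≢0 : NonZero (N ^ s)
      N^s≢0 = m^n≢0 N s {{>-nonZero N>0}}
      regroup₁ : ∀ c d n p → 3 * c * d * (n * p) ≡ c * d * (3 * n * p)
      regroup₁ = solve-∀
      regroup₂ : ∀ c d b p → c * d * (8 * b * p) ≡ 8 * c * (d * (b * p))
      regroup₂ = solve-∀
      regroup₃ : ∀ c e x y → 8 * c * (e * (x + y)) ≡ 8 * e * (c * x + c * y)
      regroup₃ = solve-∀
      regroup₄ : ∀ c x y z → c * (x * z + y * z) ≡ c * (x + y) * z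
      regroup₄ = solve-∀

  m<q+t*k : m < q + t * k
  m<q+t*k = ≰⇒> λ q+t*k≤m →
    <⇒≱ (8*10^t*[2^[1+t]+3^[1+t]]<3^[2+t]*21^t 2≤t) (q+t*k≤m⇒3^[2+t]*21^t≤8*10^t*[2^s+3^s] q+t*k≤m)

  private
    r : ℕ
    r = m ∸ t * k

    m≡r+t*k : m ≡ r + t * k
    m≡r+t*k = sym (m∸n+n≡m (m+n≤o⇒n≤o 2 (<⇒≤ 2+t*k<m)))

    2≤r : 2 ≤ r
    2≤r = m+n≤o⇒m≤o∸n 2 (<⇒≤ 2+t*k<m)

    r<q : r < q
    r<q = +-cancelʳ-< (t * k) r q (subst (_< q + t * k) m≡r+t*k m<q+t*k)

    a^t*F[r]≡B^s : a ^ t * F r ≡ B ^ s [mod N ]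
    a^t*F[r]≡B^s = begin
      a ^ t * F r         ≈⟨ F[x+j*[1+n]]≡F[n]^j*F[x] r (suc q) t ⟨
      F (r + t * k)       ≡⟨ cong F m≡r+t*k ⟨
      F m                 ≡⟨ F[m]≡B^s+N^s ⟩
      B ^ s + N * N ^ t   ≈⟨ mod-+-multiple (B ^ s) (N ^ t) ⟩
      B ^ s               ∎
      where open mod-Reasoning N

    cancel-a^t : ∀ {x y} → a ^ t * x ≡ a ^ t * y [mod N ] → x ≡ y [mod N ]
    cancel-a^t = mod-^-*-cancelˡ (F[2+n]-coprime-F[1+n] q) t

  B^s≢±a^s[mod[N]] : ¬ (B ^ s ≡ a ^ s [mod N ] ⊎ B ^ s + a ^ s ≡ 0 [mod N ])
  B^s≢±a^s[mod[N]] (inj₁ Bˢ≈aˢ) = <-irrefl (mod-<⇒≡ F[r]≈a (<-trans F[r]<a a<N) a<N) F[r]<a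
    where
    F[r]<a : F r < a
    F[r]<a = F-mono-< 2≤r (m<n⇒m<1+n r<q)
    F[r]≈a : F r ≡ a [mod N ]
    F[r]≈a = cancel-a^t (begin
      a ^ t * F r   ≈⟨ a^t*F[r]≡B^s ⟩
      B ^ s         ≈⟨ Bˢ≈aˢ ⟩
      a * a ^ t     ≡⟨ *-comm a (a ^ t) ⟩
      a ^ t * a     ∎)
      where open mod-Reasoning N
  B^s≢±a^s[mod[N]] (inj₂ Bˢ+aˢ≈0) = <-irrefl (sym F[r]+a≡0) (<-≤-trans (F[1+n]>0 q) (m≤n+m a (F r)))
    where
    F[r]+a<N : F r + a < N
    F[r]+a<N = subst (F r + a <_) (+-comm b a) (+-monoˡ-< a (F-mono-< 2≤r r<q))
    F[r]+a≡0 : F r + a ≡ 0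
    F[r]+a≡0 = mod-<⇒≡ (cancel-a^t (begin
      a ^ t * (F r + a)          ≡⟨ *-distribˡ-+ (a ^ t) (F r) a ⟩
      a ^ t * F r + a ^ t * a    ≡⟨ cong (a ^ t * F r +_) (*-comm (a ^ t) a) ⟩
      a ^ t * F r + a ^ s        ≈⟨ mod-+-cong a^t*F[r]≡B^s mod-refl ⟩
      B ^ s + a ^ s              ≈⟨ Bˢ+aˢ≈0 ⟩
      0                          ≡⟨ *-zeroʳ (a ^ t) ⟨
      a ^ t * 0                  ∎)) F[r]+a<N N>0
      where open mod-Reasoning N

3*s≰d+n : ∀ {d n m s} → 1 ≤ d → d ≤ 2 → 1 ≤ n → 3 ≤ s → F n ^ s + F (d + n) ^ s ≡ F m → 3 * s ≰ d + n
3*s≰d+n {1} {suc q} {m} {suc t} _ _ _ (s≤s 2≤t) eq 3s≤2+q =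
  B^s≢±a^s[mod[N]] {m = m} 2≤t 3s≤2+q (F[1+n]>0 q) ≤-refl (sym eq) (inj₁ mod-refl)
3*s≰d+n {2} {q} {m} {suc t} _ _ 1≤q (s≤s 2≤t) eq 3s≤2+q =
  B^s≢±a^s[mod[N]] {m = m} 2≤t 3s≤2+q (F-mono-≤ 1≤q) (F[n]≤F[1+n] q) (sym eq)
    (b^s≡±a^s[mod[a+b]] (F (suc q)) (F q) (suc t))
3*s≰d+n {suc (suc (suc _))} _ (s≤s (s≤s ())) _ _ _ _

lemma4p7 : (d n m s : ℕ) → 1 ≤ d → d ≤ 2 → 1 ≤ n → 1 ≤ m → 3 ≤ s →
    F n ^ s + F (n + d) ^ s ≡ F m → n + d < 3 * s
lemma4p7 d n m s 1≤d d≤2 1≤n _ 3≤s eq rewrite +-comm n d = ≰⇒> (3*s≰d+n {m = m} 1≤d d≤2 1≤n 3≤s eq)
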